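{- Let $X$ be a finite non-empty set and $P\in\mathfrak{P}(X)$. If $P$ is connected and $\mathrm{Crit}(P)\subseteq L(P)\times U(P)$, then $P$ is $\mathfrak{U}$-shielded. Moreover, if $P$ has an FPP-graph, then the converse also holds: if $P$ is $\mathfrak{U}$-shielded, then $\mathrm{Crit}(P)\subseteq L(P)\times U(P)$.
   Context: For a finite non-empty set $X$, $\mathfrak{P}(X)$ is the set of all posets with carrier $X$, ordered by $P\sqsubseteq Q$ iff $\leq_P\subseteq\leq_Q$; $\mathfrak{U}(P)$ denotes the set of upper covers of $P$ in $(\mathfrak{P}(X),\sqsubseteq)$. For a poset $P$: $[x,y]_P=\{z: x\leq_P z\leq_P y\}$; $x\lessdot_P y$ means $x<_P y$ and $[x,y]_P=\{x,y\}$; $L(P)$, $U(P)$ are the sets of minimal and maximal elements, $M(P)=X\setminus(L(P)\cup U(P))$; $\prec_P=\{(a,b)\in<_P: M(P)\cap[a,b]_P=\emptyset\}$. $P\setminus(a,b)=(X,\leq_P\setminus\{(a,b)\})$. $P$ is connected iff its comparability graph is connected. $P$ has an FPP-graph iff $P$ is connected and $P\setminus(a,b)$ is disconnected for all $(a,b)\in\prec_P$. $P$ is $\mathfrak{U}$-shielded iff no poset in $\mathfrak{U}(P)$ has an FPP-graph. $\mathrm{Crit}(P)$ (critical pairs) is the set of $(a,b)\in X\times X$ with $a,b$ incomparable in $P$, $\{z: z<_P a\}\subseteq\{z: z<_P b\}$ and $\{z: b<_P z\}\subseteq\{z: a<_P z\}$. -}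

module Defs where

open import Data.Nat using (ℕ)
open import Data.Fin using (Fin)
open import Data.Bool using (Bool; true)
open import Data.Product using (_×_; Σ)
open import Data.Sum using (_⊎_)
open import Relation.Nullary using (¬_)
open import Relation.Binary.PropositionalEquality using (_≡_; _≢_)
open import Relation.Binary.Construct.Closure.ReflexiveTransitive using (Star)

record Poset (n : ℕ) : Set where
  field
    le      : Fin n → Fin n → Bool
    refl    : ∀ x → le x x ≡ true
    antisym : ∀ x y → le x y ≡ true → le y x ≡ true → x ≡ y
    trans   : ∀ x y z → le x y ≡ true → le y z ≡ true → le x z ≡ true

module _ {n : ℕ} where

  _≤[_]_ : Fin n → Poset n → Fin n → Set
  x ≤[ P ] y = Poset.le P x y ≡ true

  _<[_]_ : Fin n → Poset n → Fin n → Set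
  x <[ P ] y = x ≤[ P ] y × x ≢ y

  _⊑_ : Poset n → Poset n → Set
  P ⊑ Q = ∀ x y → x ≤[ P ] y → x ≤[ Q ] y

  _⊏_ : Poset n → Poset n → Set
  P ⊏ Q = P ⊑ Q × ¬ (Q ⊑ P)

  UpperCover : Poset n → Poset n → Set
  UpperCover P Q = P ⊏ Q × (∀ (R : Poset n) → ¬ (P ⊏ R × R ⊏ Q))

  Comparable : (Fin n → Fin n → Set) → Fin n → Fin n → Set
  Comparable R x y = R x y ⊎ R y x

  ConnectedRel : (Fin n → Fin n → Set) → Set
  ConnectedRel R = ∀ x y → Star (Comparable R) x y

  Connected : Poset n → Set
  Connected P = ConnectedRel (λ x y → x ≤[ P ] y)

  removeRel : Poset n → Fin n → Fin n → Fin n → Fin n → Set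
  removeRel P a b x y = x ≤[ P ] y × ¬ (x ≡ a × y ≡ b)

  Minimal : Poset n → Fin n → Set
  Minimal P x = ∀ z → z ≤[ P ] x → z ≡ x

  Maximal : Poset n → Fin n → Set
  Maximal P x = ∀ z → x ≤[ P ] z → z ≡ x

  Middle : Poset n → Fin n → Set
  Middle P x = ¬ Minimal P x × ¬ Maximal P x

  _≺[_]_ : Fin n → Poset n → Fin n → Set
  a ≺[ P ] b = a <[ P ] b × (∀ z → a ≤[ P ] z → z ≤[ P ] b → ¬ Middle P z)

  HasFPPGraph : Poset n → Set
  HasFPPGraph P = Connected P × (∀ a b → a ≺[ P ] b → ¬ ConnectedRel (removeRel P a b))

  UShielded : Poset n → Set
  UShielded P = ∀ (Q : Poset n) → UpperCover P Q → ¬ HasFPPGraph Q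

  Incomparable : Poset n → Fin n → Fin n → Set
  Incomparable P a b = ¬ (a ≤[ P ] b) × ¬ (b ≤[ P ] a)

  Crit : Poset n → Fin n → Fin n → Set
  Crit P a b = Incomparable P a b
             × (∀ z → z <[ P ] a → z <[ P ] b)
             × (∀ z → b <[ P ] z → a <[ P ] z)

  CritInLU : Poset n → Set
  CritInLU P = ∀ a b → Crit P a b → Minimal P a × Maximal P b

-- If P ⊏ Q, some pair forced by Q but not by P can be pushed down (in its
-- lower end) and up (in its upper end) until it is a critical pair (a, b) of P.
-- Adding the single relation a ≤ b to P yields a poset P⁺ = extend P cr, and an
-- upper cover Q of P must be exactly such a P⁺.  If a is minimal and b maximal
-- in P, then a ≺ b in P⁺ and P⁺ ∖ (a, b) still contains the connected P, so P⁺
-- has no FPP-graph.  Conversely, if z < a in P, then a is a middle element of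
-- P⁺; every pair of ≺ in P⁺ is then a pair of ≺ in P, and the new edge a–b is
-- bypassed by the path a–z–b, so the FPP-graph of P passes to P⁺ (dually for
-- b < w).
module Submission where

open import Defs
open import Data.Nat using (ℕ; suc; _+_; _<_)
open import Data.Nat.Properties using (+-monoˡ-<; +-monoʳ-<)
open import Data.Nat.Induction using (<-wellFounded)
open import Data.Fin using (Fin; _≟_)
open import Data.Fin.Properties using (any?)
open import Data.Fin.Subset using (Subset; _∈_; _⊂_; ∣_∣)
open import Data.Fin.Subset.Properties using (p⊂q⇒∣p∣<∣q∣)
open import Data.Vec using (tabulate)
open import Data.Vec.Properties using (lookup∘tabulate; []=⇒lookup; lookup⇒[]=)
open import Data.Bool using (Bool; true; _∧_; _∨_)
open import Data.Bool.Properties using () renaming (_≟_ to _≟ᵇ_)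
open import Data.Product using (_×_; _,_; proj₁; proj₂; Σ; ∃; ∃₂)
open import Data.Sum using (_⊎_; inj₁; inj₂; swap; [_,_]′)
open import Data.Empty using (⊥-elim)
open import Function using (id; _on_; case_of_)
open import Induction.WellFounded using (Acc; acc)
open import Relation.Binary.Construct.On using (wellFounded)
open import Relation.Nullary using (¬_; Dec; yes; no; does)
open import Relation.Nullary.Decidable using (_×-dec_; ¬?; decidable-stable)
open import Relation.Binary.PropositionalEquality using (_≡_; refl; sym; trans; subst; _≢_)
open import Relation.Binary.Construct.Closure.ReflexiveTransitive
  using (Star; ε; _◅_; return; reverse; _⋆)

open Poset using () renaming (refl to ≤-refl; antisym to ≤-antisym; trans to ≤-trans)

module _ {n : ℕ} where

  ≤-dec : (P : Poset n) → ∀ x y → Dec (x ≤[ P ] y)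
  ≤-dec P x y = Poset.le P x y ≟ᵇ true

  <-dec : (P : Poset n) → ∀ x y → Dec (x <[ P ] y)
  <-dec P x y = ≤-dec P x y ×-dec ¬? (x ≟ y)

  ⊑-stable : (P Q : Poset n) → ¬ ¬ (P ⊑ Q) → P ⊑ Q
  ⊑-stable _ Q ¬¬P⊑Q x y x≤y =
    decidable-stable (≤-dec Q x y) (λ x≰y → ¬¬P⊑Q (λ P⊑Q → x≰y (P⊑Q x y x≤y)))

  crit-≢ : (P : Poset n) {a b : Fin n} → Crit P a b → a ≢ b
  crit-≢ P ((a≰b , _) , _) refl = a≰b (≤-refl P _)

  Middle-mono : (P Q : Poset n) → P ⊑ Q → ∀ {z} → Middle P z → Middle Q z
  Middle-mono _ _ P⊑Q (not-min , not-max) =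
    (λ min → not-min (λ w w≤z → min w (P⊑Q _ _ w≤z))) ,
    (λ max → not-max (λ w z≤w → max w (P⊑Q _ _ z≤w)))

  ≺-no-middle-span : (Q : Poset n) {c d m x y : Fin n} → c ≺[ Q ] d → Middle Q m
                   → x ≤[ Q ] m → m ≤[ Q ] y → ¬ (x ≡ c × y ≡ d)
  ≺-no-middle-span _ (_ , no-middle) mid x≤m m≤y (refl , refl) = no-middle _ x≤m m≤y mid

module _ {n : ℕ} {R S : Fin n → Fin n → Set} where

  connected-transfer : ConnectedRel R → (∀ {x y} → R x y → Star (Comparable S) x y)
                     → ConnectedRel S
  connected-transfer conn path x y = (edge ⋆) (conn x y)
    where
    edge : ∀ {x y} → Comparable R x y → Star (Comparable S) x y
    edge (inj₁ r) = path r
    edge (inj₂ r) = reverse swap (path r)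

connected-mono : {n : ℕ} (P Q : Poset n) → P ⊑ Q → Connected P → Connected Q
connected-mono _ _ P⊑Q conn = connected-transfer conn (λ x≤y → return (inj₁ (P⊑Q _ _ x≤y)))

module _ {n : ℕ} (P : Poset n) {a b : Fin n} where

  private
    le⁺ : Fin n → Fin n → Bool
    le⁺ x y = (does (x ≟ a) ∧ does (y ≟ b)) ∨ Poset.le P x y

    le⁺-elim : ∀ {x y} → le⁺ x y ≡ true → x ≤[ P ] y ⊎ (x ≡ a × y ≡ b)
    le⁺-elim {x} {y} x≤⁺y with x ≟ a | y ≟ b
    ... | yes x≡a | yes y≡b = inj₂ (x≡a , y≡b)
    ... | yes _   | no _    = inj₁ x≤⁺y
    ... | no _    | _       = inj₁ x≤⁺y

    le⁺-intro : ∀ {x y} → x ≤[ P ] y → le⁺ x y ≡ true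
    le⁺-intro {x} {y} x≤y with x ≟ a | y ≟ b
    ... | yes _ | yes _ = refl
    ... | yes _ | no _  = x≤y
    ... | no _  | _     = x≤y

    le⁺-new : ∀ {x y} → x ≡ a → y ≡ b → le⁺ x y ≡ true
    le⁺-new {x} {y} x≡a y≡b with x ≟ a | y ≟ b
    ... | yes _   | yes _   = refl
    ... | yes _   | no y≢b  = ⊥-elim (y≢b y≡b)
    ... | no x≢a  | _       = ⊥-elim (x≢a x≡a)

    module _ (cr : Crit P a b) where

      le⁺-antisym : ∀ x y → le⁺ x y ≡ true → le⁺ y x ≡ true → x ≡ y
      le⁺-antisym x y x≤y y≤x with le⁺-elim x≤y | le⁺-elim y≤x
      ... | inj₁ x≤y | inj₁ y≤x = ≤-antisym P x y x≤y y≤x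
      ... | inj₁ x≤y | inj₂ (refl , refl) = ⊥-elim (proj₂ (proj₁ cr) x≤y)
      ... | inj₂ (refl , refl) | inj₁ y≤x = ⊥-elim (proj₂ (proj₁ cr) y≤x)
      ... | inj₂ (x≡a , _) | inj₂ (y≡a , _) = trans x≡a (sym y≡a)

      -- Transitivity through the new pair is where criticality is used.
      le⁺-below : ∀ {x z} → x ≤[ P ] a → z ≡ b → le⁺ x z ≡ true
      le⁺-below {x} x≤a z≡b = case x ≟ a of λ where
        (yes x≡a) → le⁺-new x≡a z≡b
        (no x≢a)  → le⁺-intro (subst (x ≤[ P ]_) (sym z≡b)
                                 (proj₁ (proj₁ (proj₂ cr) x (x≤a , x≢a))))

      le⁺-above : ∀ {x z} → x ≡ a → b ≤[ P ] z → le⁺ x z ≡ true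
      le⁺-above {z = z} x≡a b≤z = case z ≟ b of λ where
        (yes z≡b) → le⁺-new x≡a z≡b
        (no z≢b)  → le⁺-intro (subst (_≤[ P ] z) (sym x≡a)
                                 (proj₁ (proj₂ (proj₂ cr) z (b≤z , λ b≡z → z≢b (sym b≡z)))))

      le⁺-trans : ∀ x y z → le⁺ x y ≡ true → le⁺ y z ≡ true → le⁺ x z ≡ true
      le⁺-trans x y z x≤y y≤z with le⁺-elim x≤y | le⁺-elim y≤z
      ... | inj₁ x≤y | inj₁ y≤z = le⁺-intro (≤-trans P x y z x≤y y≤z)
      ... | inj₁ x≤y | inj₂ (y≡a , z≡b) = le⁺-below (subst (x ≤[ P ]_) y≡a x≤y) z≡b
      ... | inj₂ (x≡a , y≡b) | inj₁ y≤z = le⁺-above x≡a (subst (_≤[ P ] z) y≡b y≤z)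
      ... | inj₂ (x≡a , _) | inj₂ (_ , z≡b) = le⁺-new x≡a z≡b

  extend : Crit P a b → Poset n
  extend cr = record
    { le      = le⁺
    ; refl    = λ x → le⁺-intro (≤-refl P x)
    ; antisym = le⁺-antisym cr
    ; trans   = le⁺-trans cr
    }

  module _ (cr : Crit P a b) where

    extend-≤⁻ : ∀ {x y} → x ≤[ extend cr ] y → x ≤[ P ] y ⊎ (x ≡ a × y ≡ b)
    extend-≤⁻ = le⁺-elim

    ⊑-extend : P ⊑ extend cr
    ⊑-extend _ _ = le⁺-intro

    extend-≤ab : a ≤[ extend cr ] b
    extend-≤ab = le⁺-new refl refl

    extend-least : ∀ {R} → P ⊑ R → a ≤[ R ] b → extend cr ⊑ R
    extend-least P⊑R a≤b x y x≤y with extend-≤⁻ x≤y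
    ... | inj₁ x≤Py = P⊑R x y x≤Py
    ... | inj₂ (refl , refl) = a≤b

    ⊏-extend : P ⊏ extend cr
    ⊏-extend = ⊑-extend , λ E⊑P → proj₁ (proj₁ cr) (E⊑P a b extend-≤ab)

    extend-upperCover : UpperCover P (extend cr)
    extend-upperCover = ⊏-extend , no-between
      where
      no-between : ∀ R → ¬ (P ⊏ R × R ⊏ extend cr)
      no-between R ((P⊑R , R⋢P) , (R⊑E , E⋢R)) = E⋢R (extend-least {R} P⊑R a≤Rb)
        where
        a≤Rb : a ≤[ R ] b
        a≤Rb = decidable-stable (≤-dec R a b) λ a≰Rb → R⋢P λ x y x≤Ry →
          [ id , (λ { (refl , refl) → ⊥-elim (a≰Rb x≤Ry) }) ]′ (extend-≤⁻ (R⊑E x y x≤Ry))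

module _ {n : ℕ} {f : Fin n → Bool} {x : Fin n} where

  ∈-tabulate⁺ : f x ≡ true → x ∈ tabulate f
  ∈-tabulate⁺ fx = lookup⇒[]= x (tabulate f) (trans (lookup∘tabulate f x) fx)

  ∈-tabulate⁻ : x ∈ tabulate f → f x ≡ true
  ∈-tabulate⁻ x∈ = trans (sym (lookup∘tabulate f x)) ([]=⇒lookup x∈)

module _ {n : ℕ} (P : Poset n) where

  ↓ ↑ : Fin n → Subset n
  ↓ x = tabulate (λ z → Poset.le P z x)
  ↑ x = tabulate (Poset.le P x)

  <⇒↓⊂↓ : ∀ {x y} → x <[ P ] y → ↓ x ⊂ ↓ y
  <⇒↓⊂↓ {x} {y} (x≤y , x≢y) =
    (λ z∈↓x → ∈-tabulate⁺ (≤-trans P _ x y (∈-tabulate⁻ z∈↓x) x≤y)) ,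
    y , ∈-tabulate⁺ (≤-refl P y) , λ y∈↓x → x≢y (≤-antisym P x y x≤y (∈-tabulate⁻ y∈↓x))

  <⇒↑⊂↑ : ∀ {x y} → x <[ P ] y → ↑ y ⊂ ↑ x
  <⇒↑⊂↑ {x} {y} (x≤y , x≢y) =
    (λ z∈↑y → ∈-tabulate⁺ (≤-trans P x y _ x≤y (∈-tabulate⁻ z∈↑y))) ,
    x , ∈-tabulate⁺ (≤-refl P x) , λ x∈↑y → x≢y (≤-antisym P x y x≤y (∈-tabulate⁻ x∈↑y))

module _ {n : ℕ} {P Q : Poset n} (P⊑Q : P ⊑ Q) where

  Gap : Fin n × Fin n → Set
  Gap (x , y) = x ≤[ Q ] y × ¬ x ≤[ P ] y

  weight : Fin n × Fin n → ℕ
  weight (x , y) = ∣ ↓ P x ∣ + ∣ ↑ P y ∣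

  _⋖_ : Fin n × Fin n → Fin n × Fin n → Set
  _⋖_ = _<_ on weight

  gap-crit-or-shrink : ∀ {x y} → Gap (x , y) → Crit P x y ⊎ ∃ λ p → Gap p × p ⋖ (x , y)
  gap-crit-or-shrink {x} {y} (x≤Qy , x≰y)
    with any? (λ z → <-dec P z x ×-dec ¬? (≤-dec P z y))
  ... | yes (z , z<x , z≰y) =
    inj₂ ((z , y) , (≤-trans Q z x y (P⊑Q z x (proj₁ z<x)) x≤Qy , z≰y) ,
          +-monoˡ-< ∣ ↑ P y ∣ (p⊂q⇒∣p∣<∣q∣ (<⇒↓⊂↓ P z<x)))
  ... | no ∄z with any? (λ w → <-dec P y w ×-dec ¬? (≤-dec P x w))
  ...   | yes (w , y<w , x≰w) =
    inj₂ ((x , w) , (≤-trans Q x y w x≤Qy (P⊑Q y w (proj₁ y<w)) , x≰w) ,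
          +-monoʳ-< ∣ ↓ P x ∣ (p⊂q⇒∣p∣<∣q∣ (<⇒↑⊂↑ P y<w)))
  ...   | no ∄w = inj₁ ((x≰y , y≰x) , below , above)
    where
    y≰x : ¬ y ≤[ P ] x
    y≰x y≤x = x≰y (subst (x ≤[ P ]_) (≤-antisym Q x y x≤Qy (P⊑Q y x y≤x)) (≤-refl P x))

    below : ∀ z → z <[ P ] x → z <[ P ] y
    below z z<x = decidable-stable (≤-dec P z y) (λ z≰y → ∄z (z , z<x , z≰y)) ,
                  λ z≡y → y≰x (subst (_≤[ P ] x) z≡y (proj₁ z<x))

    above : ∀ w → y <[ P ] w → x <[ P ] w
    above w y<w = decidable-stable (≤-dec P x w) (λ x≰w → ∄w (w , y<w , x≰w)) ,
                  λ x≡w → y≰x (subst (y ≤[ P ]_) (sym x≡w) (proj₁ y<w))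

  gap⇒crit : ∀ {p} → Acc _⋖_ p → Gap p → ∃₂ λ c d → Crit P c d × c ≤[ Q ] d
  gap⇒crit {x , y} (acc smaller) gap with gap-crit-or-shrink gap
  ... | inj₁ crit = x , y , crit , proj₁ gap
  ... | inj₂ (p , gap′ , p⋖xy) = gap⇒crit (smaller p⋖xy) gap′

  ⊏⇒crit : ¬ (Q ⊑ P) → ∃₂ λ c d → Crit P c d × c ≤[ Q ] d
  ⊏⇒crit Q⋢P with any? (λ x → any? (λ y → ≤-dec Q x y ×-dec ¬? (≤-dec P x y)))
  ... | yes (x , y , gap) = gap⇒crit (wellFounded weight <-wellFounded (x , y)) gap
  ... | no ∄gap = ⊥-elim (Q⋢P λ x y x≤Qy →
                    decidable-stable (≤-dec P x y) (λ x≰y → ∄gap (x , y , x≤Qy , x≰y)))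

module _ {n : ℕ} (P : Poset n) where

  upperCover⇒extend : ∀ {Q} → UpperCover P Q
                    → ∃₂ λ a b → Σ (Crit P a b) λ cr → Q ⊑ extend P cr × a ≤[ Q ] b
  upperCover⇒extend {Q} ((P⊑Q , Q⋢P) , nothing-between) with ⊏⇒crit {P = P} {Q} P⊑Q Q⋢P
  ... | a , b , cr , a≤b = a , b , cr , ⊑-stable Q (extend P cr) Q⊑E , a≤b
    where
    Q⊑E : ¬ ¬ (Q ⊑ extend P cr)
    Q⊑E Q⋢E = nothing-between (extend P cr) (⊏-extend P cr , extend-least P cr {Q} P⊑Q a≤b , Q⋢E)

  module _ {Q : Poset n} {a b : Fin n} (cr : Crit P a b) (P⊑Q : P ⊑ Q) (Q⊑E : Q ⊑ extend P cr) where

    private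
      split : ∀ {x y} → x ≤[ Q ] y → x ≤[ P ] y ⊎ (x ≡ a × y ≡ b)
      split x≤y = extend-≤⁻ P cr (Q⊑E _ _ x≤y)

      a≰b : ¬ a ≤[ P ] b
      a≰b = proj₁ (proj₁ cr)

    ¬hasFPP-extension : Connected P → Minimal P a → Maximal P b → a ≤[ Q ] b → ¬ HasFPPGraph Q
    ¬hasFPP-extension conn a-min b-max a≤b (_ , cut) = cut a b a≺b (connected-transfer conn kept)
      where
      a-minQ : Minimal Q a
      a-minQ z z≤a = [ a-min z , proj₁ ]′ (split z≤a)

      b-maxQ : Maximal Q b
      b-maxQ z b≤z = [ b-max z , proj₂ ]′ (split b≤z)

      no-middle : ∀ z → a ≤[ Q ] z → z ≤[ Q ] b → ¬ Middle Q z
      no-middle z a≤z z≤b (not-min , not-max) with split a≤z | split z≤b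
      ... | inj₂ (_ , z≡b) | _ = not-max (subst (Maximal Q) (sym z≡b) b-maxQ)
      ... | inj₁ _ | inj₂ (z≡a , _) = not-min (subst (Minimal Q) (sym z≡a) a-minQ)
      ... | inj₁ a≤Pz | inj₁ z≤Pb = a≰b (≤-trans P a z b a≤Pz z≤Pb)

      a≺b : a ≺[ Q ] b
      a≺b = (a≤b , crit-≢ P cr) , no-middle

      kept : ∀ {x y} → x ≤[ P ] y → Star (Comparable (removeRel Q a b)) x y
      kept {x} {y} x≤y = return (inj₁ (P⊑Q x y x≤y , λ { (refl , refl) → a≰b x≤y }))

  connected∧critInLU⇒shielded : Connected P → CritInLU P → UShielded P
  connected∧critInLU⇒shielded conn critInLU Q cover with upperCover⇒extend {Q} cover
  ... | a , b , cr , Q⊑E , a≤b =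
    let (a-min , b-max) = critInLU a b cr
    in ¬hasFPP-extension {Q = Q} cr (proj₁ (proj₁ cover)) Q⊑E conn a-min b-max a≤b

module _ {n : ℕ} (P : Poset n) (fpp : HasFPPGraph P) {a b : Fin n} (cr : Crit P a b) where

  private
    E : Poset n
    E = extend P cr

    P⊑E : P ⊑ E
    P⊑E = ⊑-extend P cr

    a≤b : a ≤[ E ] b
    a≤b = extend-≤ab P cr

  module _ {m : Fin n} (m-mid : Middle E m) (a≤m : a ≤[ E ] m) (m≤b : m ≤[ E ] b) where

    ≺-extend⇒≤ : ∀ {c d} → c ≺[ E ] d → c ≤[ P ] d
    ≺-extend⇒≤ ((c≤d , _) , no-middle) with extend-≤⁻ P cr c≤d
    ... | inj₁ c≤Pd = c≤Pd
    ... | inj₂ (refl , refl) = ⊥-elim (no-middle m a≤m m≤b m-mid)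

    ≺-extend⇒≺ : ∀ {c d} → c ≺[ E ] d → c ≺[ P ] d
    ≺-extend⇒≺ {c} {d} c≺d@((_ , c≢d) , no-middle) =
      (≺-extend⇒≤ c≺d , c≢d) ,
      λ z c≤z z≤d mid → no-middle z (P⊑E c z c≤z) (P⊑E z d z≤d) (Middle-mono P E P⊑E mid)

    hasFPP-extend : (∀ {c d} → c ≺[ E ] d → Star (Comparable (removeRel P c d)) a b)
                  → HasFPPGraph E
    hasFPP-extend bypass = connected-mono P E P⊑E (proj₁ fpp) , cut
      where
      cut : ∀ c d → c ≺[ E ] d → ¬ ConnectedRel (removeRel E c d)
      cut c d c≺d conn = proj₂ fpp c d (≺-extend⇒≺ c≺d) (connected-transfer conn edge)
        where
        edge : ∀ {x y} → removeRel E c d x y → Star (Comparable (removeRel P c d)) x y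
        edge {x} {y} (x≤y , x,y≢c,d) with extend-≤⁻ P cr x≤y
        ... | inj₁ x≤Py = return (inj₁ (x≤Py , x,y≢c,d))
        ... | inj₂ (refl , refl) = bypass c≺d

  hasFPP-extend-below : ∀ {z} → z <[ P ] a → HasFPPGraph E
  hasFPP-extend-below {z} z<a@(z≤a , z≢a) = hasFPP-extend a-mid (≤-refl E a) a≤b bypass
    where
    z≤Ea : z ≤[ E ] a
    z≤Ea = P⊑E z a z≤a

    a-mid : Middle E a
    a-mid = (λ a-min → z≢a (a-min z z≤Ea)) , (λ a-max → crit-≢ P cr (sym (a-max b a≤b)))

    bypass : ∀ {c d} → c ≺[ E ] d → Star (Comparable (removeRel P c d)) a b
    bypass c≺d = inj₂ (z≤a , ≺-no-middle-span E c≺d a-mid z≤Ea (≤-refl E a))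
               ◅ inj₁ (proj₁ (proj₁ (proj₂ cr) z z<a) , ≺-no-middle-span E c≺d a-mid z≤Ea a≤b)
               ◅ ε

  hasFPP-extend-above : ∀ {w} → b <[ P ] w → HasFPPGraph E
  hasFPP-extend-above {w} b<w@(b≤w , b≢w) = hasFPP-extend b-mid a≤b (≤-refl E b) bypass
    where
    b≤Ew : b ≤[ E ] w
    b≤Ew = P⊑E b w b≤w

    b-mid : Middle E b
    b-mid = (λ b-min → crit-≢ P cr (b-min a a≤b)) , (λ b-max → b≢w (sym (b-max w b≤Ew)))

    bypass : ∀ {c d} → c ≺[ E ] d → Star (Comparable (removeRel P c d)) a b
    bypass c≺d = inj₁ (proj₁ (proj₂ (proj₂ cr) w b<w) , ≺-no-middle-span E c≺d b-mid a≤b b≤Ew)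
               ◅ inj₂ (b≤w , ≺-no-middle-span E c≺d b-mid (≤-refl E b) b≤Ew)
               ◅ ε

fpp∧shielded⇒critInLU : {n : ℕ} (P : Poset n) → HasFPPGraph P → UShielded P → CritInLU P
fpp∧shielded⇒critInLU P fpp shielded a b cr = a-min , b-max
  where
  unshielded : ¬ HasFPPGraph (extend P cr)
  unshielded = shielded (extend P cr) (extend-upperCover P cr)

  a-min : Minimal P a
  a-min z z≤a = decidable-stable (z ≟ a) λ z≢a →
    unshielded (hasFPP-extend-below P fpp cr (z≤a , z≢a))

  b-max : Maximal P b
  b-max z b≤z = decidable-stable (z ≟ b) λ z≢b →
    unshielded (hasFPP-extend-above P fpp cr (b≤z , λ b≡z → z≢b (sym b≡z)))

theorem2 : (n : ℕ) (P : Poset (suc n))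
    → ((Connected P → CritInLU P → UShielded P)
    × (HasFPPGraph P → UShielded P → CritInLU P))
theorem2 n P = connected∧critInLU⇒shielded P , fpp∧shielded⇒critInLU P
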